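{- For every integer $n \geq 1$, $|\mathbf{I}_n(001)|=2^{n-1}$.
   Context: An inversion sequence of length $n$ is an integer sequence $e=(e_1,\ldots,e_n)$ with $0 \le e_i < i$ for all $i$; $\mathbf{I}_n$ is the set of these. $\mathbf{I}_n(001)$ is the set of $e\in\mathbf{I}_n$ with no indices $i<j<k$ such that $e_i=e_j<e_k$. -}

module Defs where

open import Data.Nat using (ℕ; zero; suc; _<_; _^_; _∸_)
open import Data.Fin using (Fin; toℕ)
open import Data.Vec using (Vec; []; _∷ʳ_; lookup)
open import Data.List using (List; length)
open import Data.List.Relation.Unary.All using (All)
open import Data.List.Relation.Unary.Unique.Propositional using (Unique)
open import Data.List.Membership.Propositional using (_∈_)
open import Data.Product using (Σ; _×_; ∃-syntax)
open import Relation.Binary.PropositionalEquality using (_≡_)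
open import Relation.Nullary using (¬_)

-- Inversion sequences of length n, built by appending on the right, so the
-- i-th entry (1-based) is an element of Fin i, i.e. 0 ≤ eᵢ < i.
infixl 5 _▷_
data InvSeq : ℕ → Set where
  []  : InvSeq zero
  _▷_ : ∀ {n} → InvSeq n → Fin (suc n) → InvSeq (suc n)

-- The underlying sequence of natural numbers (e₁,…,eₙ), as a vector
-- (0-based positions: position k holds e_{k+1}).
toVec : ∀ {n} → InvSeq n → Vec ℕ n
toVec []      = []
toVec (e ▷ x) = toVec e ∷ʳ toℕ x

Contains001 : ∀ {n} → InvSeq n → Set
Contains001 {n} e =
  Σ (Fin n) λ i → Σ (Fin n) λ j → Σ (Fin n) λ k →
    (toℕ i < toℕ j × toℕ j < toℕ k ×
     lookup (toVec e) i ≡ lookup (toVec e) j ×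
     lookup (toVec e) j < lookup (toVec e) k)

Avoids001 : ∀ {n} → InvSeq n → Set
Avoids001 e = ¬ Contains001 e

CountAvoiders001 : ℕ → ℕ → Set
CountAvoiders001 n m =
  Σ (List (InvSeq n)) λ L → (Unique L × All Avoids001 L ×
          (∀ (e : InvSeq n) → Avoids001 e → e ∈ L) × length L ≡ m)

module Submission where

open import Defs
open import Data.Nat using (ℕ; zero; suc; _+_; _∸_; _^_; _<_; _≤_; _<?_; z≤n; s≤s; s≤s⁻¹)
open import Data.Nat.Properties
open import Data.Fin using (Fin; toℕ; inject₁; fromℕ; fromℕ<)
  renaming (zero to fzero; suc to fsuc)
import Data.Fin.Properties as Fin
open import Data.Fin.Relation.Unary.Top using (view; ‵fromℕ; ‵inject₁)
open import Data.Vec using (Vec; []; _∷_; _∷ʳ_; lookup)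
open import Data.List using (List; []; _∷_; _++_; map; length)
open import Data.List.Properties using (length-++; length-map)
import Data.List.Relation.Unary.All as All
open import Data.List.Relation.Unary.Any using (here)
open import Data.List.Relation.Unary.AllPairs using ([]; _∷_)
open import Data.List.Relation.Unary.Unique.Propositional using (Unique)
import Data.List.Relation.Unary.Unique.Propositional.Properties as Unique
open import Data.List.Membership.Propositional using (_∈_)
open import Data.List.Membership.Propositional.Properties using (∈-map⁺; ∈-map⁻; ∈-++⁺ˡ; ∈-++⁺ʳ; ∈-++⁻)
open import Data.Product using (Σ; _×_; _,_; proj₁; proj₂)
open import Data.Sum using (_⊎_; inj₁; inj₂)
open import Data.Empty using (⊥-elim)
open import Function using (_∘_)
open import Relation.Binary.PropositionalEquality
open import Relation.Nullary using (¬_; Dec; yes; no)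

-- Let e be a 001-avoiding inversion sequence of length n.  Either e is the
-- identity 0,1,…,n-1, or e = e' ▷ y with y < n-1 and every value ≤ y
-- occurring in e'.  Consequently the entries x for which e ▷ x still avoids
-- 001 are exactly the x < cap e, where cap of the identity of length n is
-- n+1 and cap (e' ▷ y) = y+1 otherwise.
--
-- Finally the avoiders of length n+1 with cap > n ∸ k
-- are listed by recursion on k: those with cap > n+1 ∸ k, and the avoiders
-- of length n with cap > n ∸ k followed by the entry n ∸ k, which are
-- exactly the ones of capacity n ∸ k + 1.  The list doubles at each step,
-- and for k = n it holds all 2 ^ n avoiders of length n+1.

val : ∀ {n} → InvSeq n → Fin n → ℕ
val e = lookup (toVec e)

lookup-∷ʳ-inject₁ : ∀ {A : Set} {n} (v : Vec A n) (a : A) (i : Fin n) →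
                    lookup (v ∷ʳ a) (inject₁ i) ≡ lookup v i
lookup-∷ʳ-inject₁ (b ∷ v) a fzero   = refl
lookup-∷ʳ-inject₁ (b ∷ v) a (fsuc i) = lookup-∷ʳ-inject₁ v a i

lookup-∷ʳ-last : ∀ {A : Set} {n} (v : Vec A n) (a : A) → lookup (v ∷ʳ a) (fromℕ n) ≡ a
lookup-∷ʳ-last []      a = refl
lookup-∷ʳ-last (b ∷ v) a = lookup-∷ʳ-last v a

val-inject₁ : ∀ {n} (e : InvSeq n) (x : Fin (suc n)) (i : Fin n) → val (e ▷ x) (inject₁ i) ≡ val e i
val-inject₁ e x = lookup-∷ʳ-inject₁ (toVec e) (toℕ x)

val-last : ∀ {n} (e : InvSeq n) (x : Fin (suc n)) → val (e ▷ x) (fromℕ n) ≡ toℕ x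
val-last e x = lookup-∷ʳ-last (toVec e) (toℕ x)

inject₁-mono : ∀ {n} {i j : Fin n} → toℕ i < toℕ j → toℕ (inject₁ i) < toℕ (inject₁ j)
inject₁-mono {i = i} {j} = subst₂ _<_ (sym (Fin.toℕ-inject₁ i)) (sym (Fin.toℕ-inject₁ j))

inject₁-reflects : ∀ {n} {i j : Fin n} → toℕ (inject₁ i) < toℕ (inject₁ j) → toℕ i < toℕ j
inject₁-reflects {i = i} {j} = subst₂ _<_ (Fin.toℕ-inject₁ i) (Fin.toℕ-inject₁ j)

inject₁<last : ∀ {n} (i : Fin n) → toℕ (inject₁ i) < toℕ (fromℕ n)
inject₁<last {n} i = subst (toℕ (inject₁ i) <_) (sym (Fin.toℕ-fromℕ n)) (Fin.inject₁ℕ< i)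

before⇒inject₁ : ∀ {n} (j k : Fin (suc n)) → toℕ j < toℕ k → Σ (Fin n) λ j' → j ≡ inject₁ j'
before⇒inject₁ {n} j k j<k with view j
... | ‵inject₁ j' = j' , refl
... | ‵fromℕ = ⊥-elim (<-irrefl refl (<-≤-trans j<k k≤last))
  where
    k≤last : toℕ k ≤ toℕ (fromℕ n)
    k≤last = subst (toℕ k ≤_) (sym (Fin.toℕ-fromℕ n)) (s≤s⁻¹ (Fin.toℕ<n k))

-- x is obstructed after e when e repeats a value smaller than x: appending
-- x then completes a 001 pattern.
Obstructed : ∀ {n} → InvSeq n → ℕ → Set
Obstructed {n} e x = Σ (Fin n) λ i → Σ (Fin n) λ j →
  toℕ i < toℕ j × val e i ≡ val e j × val e j < x

extend001 : ∀ {n} (e : InvSeq n) (x : Fin (suc n)) → Contains001 e → Contains001 (e ▷ x)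
extend001 e x (i , j , k , i<j , j<k , eq , lt) =
  inject₁ i , inject₁ j , inject₁ k , inject₁-mono i<j , inject₁-mono j<k ,
  trans (val-inject₁ e x i) (trans eq (sym (val-inject₁ e x j))) ,
  subst₂ _<_ (sym (val-inject₁ e x j)) (sym (val-inject₁ e x k)) lt

obstructed001 : ∀ {n} (e : InvSeq n) (x : Fin (suc n)) → Obstructed e (toℕ x) → Contains001 (e ▷ x)
obstructed001 {n} e x (i , j , i<j , eq , lt) =
  inject₁ i , inject₁ j , fromℕ n , inject₁-mono i<j , inject₁<last j ,
  trans (val-inject₁ e x i) (trans eq (sym (val-inject₁ e x j))) ,
  subst₂ _<_ (sym (val-inject₁ e x j)) (sym (val-last e x)) lt

split001 : ∀ {n} (e : InvSeq n) (x : Fin (suc n)) → Contains001 (e ▷ x) →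
           Contains001 e ⊎ Obstructed e (toℕ x)
split001 e x (i , j , k , i<j , j<k , eq , lt)
  with before⇒inject₁ j k j<k
... | j' , refl with before⇒inject₁ i (inject₁ j') i<j
... | i' , refl with view k
... | ‵inject₁ k' = inj₁ (i' , j' , k' , inject₁-reflects i<j , inject₁-reflects j<k , eq′ ,
                         subst₂ _<_ (val-inject₁ e x j') (val-inject₁ e x k') lt)
  where eq′ = trans (sym (val-inject₁ e x i')) (trans eq (val-inject₁ e x j'))
... | ‵fromℕ = inj₂ (i' , j' , inject₁-reflects i<j , eq′ ,
                    subst₂ _<_ (val-inject₁ e x j') (val-last e x) lt)
  where eq′ = trans (sym (val-inject₁ e x i')) (trans eq (val-inject₁ e x j'))

avoids-init : ∀ {n} (e : InvSeq n) (x : Fin (suc n)) → Avoids001 (e ▷ x) → Avoids001 e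
avoids-init e x av = av ∘ extend001 e x

avoids-snoc : ∀ {n} (e : InvSeq n) (x : Fin (suc n)) →
              Avoids001 e → ¬ Obstructed e (toℕ x) → Avoids001 (e ▷ x)
avoids-snoc e x av unobstructed p with split001 e x p
... | inj₁ p′ = av p′
... | inj₂ o  = unobstructed o

idSeq : ∀ n → InvSeq n
idSeq zero    = []
idSeq (suc n) = idSeq n ▷ fromℕ n

val-idSeq : ∀ n (i : Fin n) → val (idSeq n) i ≡ toℕ i
val-idSeq (suc n) i with view i
... | ‵inject₁ j = begin
  val (idSeq (suc n)) (inject₁ j) ≡⟨ val-inject₁ (idSeq n) (fromℕ n) j ⟩
  val (idSeq n) j                 ≡⟨ val-idSeq n j ⟩
  toℕ j                           ≡⟨ sym (Fin.toℕ-inject₁ j) ⟩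
  toℕ (inject₁ j)                 ∎
  where open ≡-Reasoning
... | ‵fromℕ = val-last (idSeq n) (fromℕ n)

idSeq-unobstructed : ∀ n x → ¬ Obstructed (idSeq n) x
idSeq-unobstructed n x (i , j , i<j , eq , _) =
  <-irrefl (trans (sym (val-idSeq n i)) (trans eq (val-idSeq n j))) i<j

idSeq-avoids : ∀ n → Avoids001 (idSeq n)
idSeq-avoids zero    (() , _)
idSeq-avoids (suc n) = avoids-snoc (idSeq n) (fromℕ n) (idSeq-avoids n) (idSeq-unobstructed n _)

▷-injectiveˡ : ∀ {n} {e e' : InvSeq n} {x x'} → e ▷ x ≡ e' ▷ x' → e ≡ e'
▷-injectiveˡ refl = refl

▷-injectiveʳ : ∀ {n} {e e' : InvSeq n} {x x'} → e ▷ x ≡ e' ▷ x' → x ≡ x'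
▷-injectiveʳ refl = refl

isId? : ∀ {n} (e : InvSeq n) → Dec (e ≡ idSeq n)
isId? [] = yes refl
isId? {suc n} (e ▷ x) with isId? e | x Fin.≟ fromℕ n
... | yes refl | yes refl = yes refl
... | no e≢id  | _        = no (e≢id ∘ ▷-injectiveˡ)
... | yes _    | no x≢top = no (x≢top ∘ ▷-injectiveʳ)

-- The capacity of e: for an avoider, the number of entries x with e ▷ x
-- still avoiding 001 (extend-below-cap, snoc-below-cap).
cap : ∀ {n} → InvSeq n → ℕ
cap [] = 1
cap {suc n} (e ▷ x) with isId? (e ▷ x)
... | yes _ = suc (suc n)
... | no  _ = suc (toℕ x)

cap-idSeq : ∀ n → cap (idSeq n) ≡ suc n
cap-idSeq zero = refl
cap-idSeq (suc n) with isId? (idSeq (suc n))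
... | yes _   = refl
... | no ≢id = ⊥-elim (≢id refl)

cap-snoc : ∀ {n} (e : InvSeq n) (x : Fin (suc n)) → e ▷ x ≢ idSeq (suc n) → cap (e ▷ x) ≡ suc (toℕ x)
cap-snoc e x ≢id with isId? (e ▷ x)
... | yes ≡id = ⊥-elim (≢id ≡id)
... | no  _   = refl

cap-positive : ∀ {n} (e : InvSeq n) → 0 < cap e
cap-positive [] = s≤s z≤n
cap-positive (e ▷ x) with isId? (e ▷ x)
... | yes _ = s≤s z≤n
... | no  _ = s≤s z≤n

Occurs : ∀ {n} → InvSeq n → ℕ → Set
Occurs {n} e z = Σ (Fin n) λ i → val e i ≡ z

occurs-snoc : ∀ {n} (e : InvSeq n) (x : Fin (suc n)) {z} → Occurs e z → Occurs (e ▷ x) z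
occurs-snoc e x (i , eq) = inject₁ i , trans (val-inject₁ e x i) eq

repeat-obstructs : ∀ {n} (e : InvSeq n) (w : Fin (suc n)) {x} →
                   Occurs e (toℕ w) → toℕ w < x → Obstructed (e ▷ w) x
repeat-obstructs {n} e w {x} (i , eq) w<x =
  inject₁ i , fromℕ n , inject₁<last i ,
  trans (val-inject₁ e w i) (trans eq (sym (val-last e w))) ,
  subst (_< x) (sym (val-last e w)) w<x

idSeq-shape : ∀ n (y : Fin (suc n)) → y ≢ fromℕ n →
              (∀ z → z ≤ toℕ y → Occurs (idSeq n) z) × toℕ y < n
idSeq-shape n y y≢top = occurs , y<n
  where
    y<n : toℕ y < n
    y<n = ≤∧≢⇒< (s≤s⁻¹ (Fin.toℕ<n y))
                (λ y≡n → y≢top (Fin.toℕ-injective (trans y≡n (sym (Fin.toℕ-fromℕ n)))))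
    occurs : ∀ z → z ≤ toℕ y → Occurs (idSeq n) z
    occurs z z≤y = fromℕ< z<n , trans (val-idSeq n (fromℕ< z<n)) (Fin.toℕ-fromℕ< z<n)
      where z<n = <-≤-trans (s≤s z≤y) y<n

-- Inductively, y lies below the previous last entry w, since a
-- larger y would be obstructed by the repetition of w.
nonId-shape : ∀ {n} (e : InvSeq n) (y : Fin (suc n)) → Avoids001 (e ▷ y) → e ▷ y ≢ idSeq (suc n) →
              (∀ z → z ≤ toℕ y → Occurs e z) × toℕ y < n
nonId-shape [] fzero av ≢id = ⊥-elim (≢id refl)
nonId-shape (e ▷ w) y av ≢id with isId? (e ▷ w)
... | yes refl = idSeq-shape _ y (≢id ∘ cong (idSeq _ ▷_))
... | no w-nonId with nonId-shape e w (avoids-init (e ▷ w) y av) w-nonId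
... | occurs , w<n with toℕ y ≤? toℕ w
... | yes y≤w = (λ z z≤y → occurs-snoc e w (occurs z (≤-trans z≤y y≤w))) ,
                ≤-trans (s≤s y≤w) (m≤n⇒m≤1+n w<n)
... | no  y≰w = ⊥-elim (av (obstructed001 (e ▷ w) y
                  (repeat-obstructs e w (occurs (toℕ w) ≤-refl) (≰⇒> y≰w))))

-- Below the capacity of an avoider nothing is obstructed: the identity has
-- no repetition, and an obstruction of x ≤ y after e ▷ y would either use
-- the last entry (impossible as y ≥ x) or extend to a 001 ending at y.
below-cap-unobstructed : ∀ {n} (e : InvSeq n) (x : ℕ) → Avoids001 e → x < cap e → ¬ Obstructed e x
below-cap-unobstructed [] x av x<cap (() , _)
below-cap-unobstructed {suc n} (e ▷ y) x av x<cap o@(i , j , i<j , eq , lt) with isId? (e ▷ y)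
... | yes refl = idSeq-unobstructed (suc n) x o
... | no _ with view j
... | ‵fromℕ      = <-irrefl refl (<-≤-trans (subst (_< x) (val-last e y) lt) (s≤s⁻¹ x<cap))
... | ‵inject₁ j' = av (i , inject₁ j' , fromℕ n , i<j , inject₁<last j' , eq ,
                        subst (val (e ▷ y) (inject₁ j') <_) (sym (val-last e y))
                              (<-≤-trans lt (s≤s⁻¹ x<cap)))

-- At or above the capacity every entry is obstructed, by the repetition
-- of the last entry y (which occurs earlier by nonId-shape).
cap-obstructed : ∀ {n} (e : InvSeq n) (x : Fin (suc n)) → Avoids001 e → cap e ≤ toℕ x → Obstructed e (toℕ x)
cap-obstructed [] fzero av ()
cap-obstructed (e ▷ y) x av cap≤x with isId? (e ▷ y)
... | yes _     = ⊥-elim (<-irrefl refl (<-≤-trans (Fin.toℕ<n x) cap≤x))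
... | no nonId = repeat-obstructs e y (proj₁ (nonId-shape e y av nonId) (toℕ y) ≤-refl) cap≤x

extend-below-cap : ∀ {n} (e : InvSeq n) (x : Fin (suc n)) → Avoids001 e → toℕ x < cap e → Avoids001 (e ▷ x)
extend-below-cap e x av x<cap = avoids-snoc e x av (below-cap-unobstructed e (toℕ x) av x<cap)

snoc-below-cap : ∀ {n} (e : InvSeq n) (x : Fin (suc n)) → Avoids001 (e ▷ x) → toℕ x < cap e
snoc-below-cap e x av with toℕ x <? cap e
... | yes x<cap = x<cap
... | no  x≮cap = ⊥-elim (av (obstructed001 e x (cap-obstructed e x (avoids-init e x av) (≮⇒≥ x≮cap))))

large-cap⇒idSeq : ∀ {n} (e : InvSeq (suc n)) → Avoids001 e → n < cap e → e ≡ idSeq (suc n)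
large-cap⇒idSeq (e ▷ y) av n<cap with isId? (e ▷ y)
... | yes ≡id   = ≡id
... | no  nonId = ⊥-elim (<-irrefl refl (<-≤-trans n<cap (proj₂ (nonId-shape e y av nonId))))

entry : (n k : ℕ) → Fin (suc (suc n))
entry n k = fromℕ< (s≤s (m≤n⇒m≤1+n (m∸n≤m n k)))

toℕ-entry : ∀ n k → toℕ (entry n k) ≡ n ∸ k
toℕ-entry n k = Fin.toℕ-fromℕ< (s≤s (m≤n⇒m≤1+n (m∸n≤m n k)))

-- Appending n ∸ k ≤ n never gives the identity, so the capacity becomes n ∸ k + 1.
cap-entry : ∀ n k (e : InvSeq (suc n)) → cap (e ▷ entry n k) ≡ suc (n ∸ k)
cap-entry n k e = trans (cap-snoc e (entry n k) ≢id) (cong suc (toℕ-entry n k))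
  where
    ≢id : e ▷ entry n k ≢ idSeq (suc (suc n))
    ≢id eq = <-irrefl (trans (sym (toℕ-entry n k)) (trans (cong toℕ (▷-injectiveʳ eq)) (Fin.toℕ-fromℕ (suc n))))
                      (s≤s (m∸n≤m n k))

exact-cap : ∀ n k (e : InvSeq (suc (suc n))) → Avoids001 e → cap e ≡ suc (n ∸ k) →
            Σ (InvSeq (suc n)) λ e' → e ≡ e' ▷ entry n k × Avoids001 e' × n ∸ k < cap e'
exact-cap n k (e' ▷ x) av cap≡ with isId? (e' ▷ x)
... | yes _ = ⊥-elim (<-irrefl (sym cap≡) (s≤s (s≤s (m≤n⇒m≤1+n (m∸n≤m n k)))))
... | no  _ = e' , cong (e' ▷_) x≡entry , avoids-init e' x av ,
              subst (_< cap e') x≡n∸k (snoc-below-cap e' x av)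
  where
    x≡n∸k : toℕ x ≡ n ∸ k
    x≡n∸k = suc-injective cap≡
    x≡entry : x ≡ entry n k
    x≡entry = Fin.toℕ-injective (trans x≡n∸k (sym (toℕ-entry n k)))

-- avoiders n k lists, for k ≤ n, the avoiders of length n+1 with capacity
-- > n ∸ k: those with capacity > n+1 ∸ k and those of capacity exactly
-- n ∸ k + 1 (described by exact-cap).
avoiders : (n k : ℕ) → List (InvSeq (suc n))
avoiders n       zero    = idSeq (suc n) ∷ []
avoiders zero    (suc k) = []
avoiders (suc n) (suc k) = avoiders (suc n) k ++ map (_▷ entry n k) (avoiders n k)

avoiders-sound : ∀ n k → k ≤ n → ∀ {e} → e ∈ avoiders n k → Avoids001 e × n ∸ k < cap e
avoiders-sound n zero _ (here refl) =
  idSeq-avoids (suc n) , subst (n <_) (sym (cap-idSeq (suc n))) (m<n⇒m<1+n (n<1+n n))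
avoiders-sound (suc n) (suc k) (s≤s k≤n) m with ∈-++⁻ (avoiders (suc n) k) m
... | inj₁ m₁ = let av , lt = avoiders-sound (suc n) k (m≤n⇒m≤1+n k≤n) m₁
                in av , ≤-<-trans (∸-monoˡ-≤ k (n≤1+n n)) lt
... | inj₂ m₂ with ∈-map⁻ (_▷ entry n k) m₂
... | e' , m' , refl = let av' , lt' = avoiders-sound n k k≤n m'
                       in extend-below-cap e' (entry n k) av' (subst (_< cap e') (sym (toℕ-entry n k)) lt') ,
                          subst (n ∸ k <_) (sym (cap-entry n k e')) (n<1+n (n ∸ k))

avoiders-complete : ∀ n k → k ≤ n → (e : InvSeq (suc n)) → Avoids001 e → n ∸ k < cap e → e ∈ avoiders n k
avoiders-complete n zero _ e av n<cap = here (large-cap⇒idSeq e av n<cap)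
avoiders-complete (suc n) (suc k) (s≤s k≤n) e av lt with suc n ∸ k <? cap e
... | yes lt′ = ∈-++⁺ˡ (avoiders-complete (suc n) k (m≤n⇒m≤1+n k≤n) e av lt′)
... | no  ≮lt with exact-cap n k e av (≤-antisym cap≤ lt)
  where cap≤ = subst (cap e ≤_) (+-∸-assoc 1 k≤n) (≮⇒≥ ≮lt)
... | e' , refl , av' , lt' =
  ∈-++⁺ʳ (avoiders (suc n) k) (∈-map⁺ (_▷ entry n k) (avoiders-complete n k k≤n e' av' lt'))

avoiders-unique : ∀ n k → k ≤ n → Unique (avoiders n k)
avoiders-unique n zero _ = All.[] ∷ []
avoiders-unique (suc n) (suc k) (s≤s k≤n) =
  Unique.++⁺ (avoiders-unique (suc n) k (m≤n⇒m≤1+n k≤n))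
             (Unique.map⁺ ▷-injectiveˡ (avoiders-unique n k k≤n)) disjoint
  where
    -- the two parts have different capacities
    disjoint : ∀ {e} → ¬ (e ∈ avoiders (suc n) k × e ∈ map (_▷ entry n k) (avoiders n k))
    disjoint (m₁ , m₂) with ∈-map⁻ (_▷ entry n k) m₂
    ... | e' , _ , refl = <-irrefl (trans (+-∸-assoc 1 k≤n) (sym (cap-entry n k e')))
                                   (proj₂ (avoiders-sound (suc n) k (m≤n⇒m≤1+n k≤n) m₁))

avoiders-length : ∀ n k → k ≤ n → length (avoiders n k) ≡ 2 ^ k
avoiders-length n zero _ = refl
avoiders-length (suc n) (suc k) (s≤s k≤n) = begin
  length (avoiders (suc n) k ++ map (_▷ entry n k) (avoiders n k))
    ≡⟨ length-++ (avoiders (suc n) k) ⟩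
  length (avoiders (suc n) k) + length (map (_▷ entry n k) (avoiders n k))
    ≡⟨ cong₂ _+_ (avoiders-length (suc n) k (m≤n⇒m≤1+n k≤n))
                 (trans (length-map (_▷ entry n k) (avoiders n k)) (avoiders-length n k k≤n)) ⟩
  2 ^ k + 2 ^ k
    ≡⟨ cong (2 ^ k +_) (sym (+-identityʳ (2 ^ k))) ⟩
  2 ^ suc k ∎
  where open ≡-Reasoning

-- Every sequence has positive capacity, so for k = n the list contains all avoiders.
theorem10 : (n : ℕ) → CountAvoiders001 (suc n) (2 ^ n)
theorem10 n =
  avoiders n n , avoiders-unique n n ≤-refl ,
  All.tabulate (proj₁ ∘ avoiders-sound n n ≤-refl) , complete ,
  avoiders-length n n ≤-refl
  where
    complete : ∀ e → Avoids001 e → e ∈ avoiders n n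
    complete e av = avoiders-complete n n ≤-refl e av
                      (subst (_< cap e) (sym (n∸n≡0 n)) (cap-positive e))
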